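{- Let $(\gamma,x_0)$ and $(\delta,y_0)$ be based, reachable cellular automata, with $\gamma\colon X\to CX$, $\delta\colon Y\to CY$, and let $f\colon X\to Y$ be a pre-cellular morphism $\gamma\to\delta$ with $f(x_0)=y_0$. If there is a pre-cellular morphism $g\colon\delta\to\gamma$ with $g(y_0)=x_0$, then $f$ and $g$ are mutually inverse, and $f$ is a cellular isomorphism with inverse $g$: the pairs $(f,g^*)$ and $(g,f^*)$ are mutually inverse cellular morphisms.
   Context: Fix a monoid $(M,\cdot,e)$, a subset $N\subseteq M$ with inclusion $i\colon N\hookrightarrow M$, and a set $S$ of states. $[A,B]$ is the set of maps $A\to B$. For $a\colon M\to X$ let $I^a\subseteq[N,S]$ be the set of $f\colon N\to S$ with $f(n)=f(n')$ whenever $a(i(n))=a(i(n'))$; for $h\colon X\to Y$, $I^{h\circ a}\subseteq I^a$. Let $CX=\coprod_{a\colon M\to X}[I^a,S]$, $(Ch)(a,f)=(h\circ a, f|_{I^{h\circ a}})$. A cellular automaton is $\gamma\colon X\to CX$, $\gamma(x)=(\gamma_1(x),\gamma_2(x))$ with $\gamma_1(x)\colon M\to X$, $\gamma_2(x)\colon I^{\gamma_1(x)}\to S$, such that $\gamma_1(x)(e)=x$ and $\gamma_1(\gamma_1(x)(m))(n)=\gamma_1(x)(n\cdot m)$. A pre-cellular morphism $h\colon\gamma\to\delta$ is a map with $Ch\circ\gamma=\delta\circ h$. Configurations $X^*=[X,S]$; for $h\colon X\to Y$, $h^*\colon Y^*\to X^*$, $h^*(c)=c\circ h$. A cellular morphism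 $\gamma\to\delta$ is a pair $(f,s)$ with $f$ pre-cellular and $s\colon X^*\to Y^*$ satisfying $f^*\circ s=\mathrm{id}$; cellular morphisms compose by $(g,r)\circ(f,s)=(g\circ f,r\circ s)$ with identities $(\mathrm{id},\mathrm{id})$. A based cellular automaton $(\gamma,x_0)$ is reachable if $\gamma_1(x_0)\colon M\to X$ is surjective. -}

module Defs where

open import Data.Product using (Σ; ∃; _×_; _,_; proj₁; proj₂)
open import Relation.Binary.PropositionalEquality using (_≡_; cong)
open import Algebra.Structures using (IsMonoid)
open import Function.Definitions using (Injective)
open import Function using (_∘_; id)

record Setting : Set₁ where
  field
    M           : Set
    _·_         : M → M → M
    e           : M
    isMonoid    : IsMonoid _≡_ _·_ e
    N           : Set
    i           : N → M
    i-injective : Injective _≡_ _≡_ i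
    S           : Set

module _ (𝔖 : Setting) where
  open Setting 𝔖

  Compat : {X : Set} → (M → X) → (N → S) → Set
  Compat a φ = ∀ n n' → a (i n) ≡ a (i n') → φ n ≡ φ n'

  I : {X : Set} → (M → X) → Set
  I a = Σ (N → S) (Compat a)

  C : Set → Set
  C X = Σ (M → X) (λ a → I a → S)

  restrict-compat : {X Y : Set} (h : X → Y) (a : M → X) {φ : N → S} →
                    Compat (h ∘ a) φ → Compat a φ
  restrict-compat h a p n n' q = p n n' (cong h q)

  Cmap : {X Y : Set} → (X → Y) → C X → C Y
  Cmap h (a , F) = (h ∘ a , λ { (φ , p) → F (φ , restrict-compat h a p) })

  _≈C_ : {X : Set} → C X → C X → Set
  (a , F) ≈C (b , G) =
    (∀ m → a m ≡ b m) ×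
    (∀ (φ : N → S) (p : Compat a φ) (q : Compat b φ) → F (φ , p) ≡ G (φ , q))

  γ₁ : {X : Set} → (X → C X) → X → M → X
  γ₁ γ x = proj₁ (γ x)

  IsCellularAutomaton : {X : Set} → (X → C X) → Set
  IsCellularAutomaton γ =
    (∀ x → γ₁ γ x e ≡ x) ×
    (∀ x m n → γ₁ γ (γ₁ γ x m) n ≡ γ₁ γ x (n · m))

  Reachable : {X : Set} → (X → C X) → X → Set
  Reachable γ x₀ = ∀ x → ∃ λ m → γ₁ γ x₀ m ≡ x

  IsPreCellular : {X Y : Set} → (X → C X) → (Y → C Y) → (X → Y) → Set
  IsPreCellular γ δ h = ∀ x → Cmap h (γ x) ≈C δ (h x)

  Conf : Set → Set
  Conf X = X → S

  _* : {X Y : Set} → (X → Y) → Conf Y → Conf X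
  (h *) c = c ∘ h

  CellPair : Set → Set → Set
  CellPair X Y = (X → Y) × (Conf X → Conf Y)

  IsCellularMorphism : {X Y : Set} → (X → C X) → (Y → C Y) → CellPair X Y → Set
  IsCellularMorphism {X} γ δ (f , s) =
    IsPreCellular γ δ f × (∀ (c : Conf X) x → (f *) (s c) x ≡ c x)

  _∘C_ : {X Y Z : Set} → CellPair Y Z → CellPair X Y → CellPair X Z
  (g , r) ∘C (f , s) = (g ∘ f , r ∘ s)

  idC : {X : Set} → CellPair X X
  idC = (id , id)

  _≈M_ : {X Y : Set} → CellPair X Y → CellPair X Y → Set
  _≈M_ {X} (f , s) (f' , s') =
    (∀ x → f x ≡ f' x) × (∀ (c : Conf X) y → s c y ≡ s' c y)

-- A pre-cellular morphism commutes with the orbit maps γ₁, so on a reachable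
-- automaton, where every state is γ₁ x₀ m for some m, it is determined by its
-- value at the base point. Both g ∘ f and the identity commute with γ₁ and fix
-- x₀, hence coincide; symmetrically f ∘ g = id. The configuration maps g* and f*
-- are then inverse to each other because f and g are.
{-# OPTIONS --safe #-}
module Submission where

open import Defs
open import Data.Product using (_×_; _,_; proj₁)
open import Function using (_∘_; id)
open import Relation.Binary.PropositionalEquality using (_≡_; refl; trans; cong; module ≡-Reasoning)

module _ (𝔖 : Setting) where
  open Setting 𝔖 using (M)

  private variable
    X Y Z : Set

  OrbitPreserving : (X → C 𝔖 X) → (Y → C 𝔖 Y) → (X → Y) → Set
  OrbitPreserving {X} γ δ h = ∀ (x : X) (m : M) → h (γ₁ 𝔖 γ x m) ≡ γ₁ 𝔖 δ (h x) m

  preCellular⇒orbitPreserving : (γ : X → C 𝔖 X) (δ : Y → C 𝔖 Y) (h : X → Y) →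
    IsPreCellular 𝔖 γ δ h → OrbitPreserving γ δ h
  preCellular⇒orbitPreserving γ δ h h-pre x = proj₁ (h-pre x)

  orbitPreserving-∘ : (γ : X → C 𝔖 X) (δ : Y → C 𝔖 Y) (ε : Z → C 𝔖 Z) (h : X → Y) (k : Y → Z) →
    OrbitPreserving δ ε k → OrbitPreserving γ δ h → OrbitPreserving γ ε (k ∘ h)
  orbitPreserving-∘ γ δ ε h k k-orb h-orb x m = begin
    k (h (γ₁ 𝔖 γ x m))   ≡⟨ cong k (h-orb x m) ⟩
    k (γ₁ 𝔖 δ (h x) m)   ≡⟨ k-orb (h x) m ⟩
    γ₁ 𝔖 ε (k (h x)) m   ∎
    where open ≡-Reasoning

  orbitPreserving-id : (γ : X → C 𝔖 X) → OrbitPreserving γ γ id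
  orbitPreserving-id γ x m = refl

  orbitPreserving-unique : (γ : X → C 𝔖 X) (δ : Y → C 𝔖 Y) {x₀ : X} (h k : X → Y) →
    Reachable 𝔖 γ x₀ → OrbitPreserving γ δ h → OrbitPreserving γ δ k →
    h x₀ ≡ k x₀ → ∀ x → h x ≡ k x
  orbitPreserving-unique γ δ {x₀} h k reach h-orb k-orb h≡k x with reach x
  ... | m , refl = begin
    h (γ₁ 𝔖 γ x₀ m)    ≡⟨ h-orb x₀ m ⟩
    γ₁ 𝔖 δ (h x₀) m    ≡⟨ cong (λ y → γ₁ 𝔖 δ y m) h≡k ⟩
    γ₁ 𝔖 δ (k x₀) m    ≡⟨ k-orb x₀ m ⟨
    k (γ₁ 𝔖 γ x₀ m)    ∎
    where open ≡-Reasoning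

  preCellular-retraction : (γ : X → C 𝔖 X) (δ : Y → C 𝔖 Y) {x₀ : X} {y₀ : Y} (f : X → Y) (g : Y → X) →
    Reachable 𝔖 γ x₀ → IsPreCellular 𝔖 γ δ f → f x₀ ≡ y₀ → IsPreCellular 𝔖 δ γ g → g y₀ ≡ x₀ →
    ∀ x → g (f x) ≡ x
  preCellular-retraction γ δ f g reach f-pre fx₀≡y₀ g-pre gy₀≡x₀ =
    orbitPreserving-unique γ γ (g ∘ f) id reach
      (orbitPreserving-∘ γ δ γ f g (preCellular⇒orbitPreserving δ γ g g-pre)
        (preCellular⇒orbitPreserving γ δ f f-pre))
      (orbitPreserving-id γ)
      (trans (cong g fx₀≡y₀) gy₀≡x₀)

  cellular-with-retraction : (γ : X → C 𝔖 X) (δ : Y → C 𝔖 Y) (f : X → Y) (g : Y → X) →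
    IsPreCellular 𝔖 γ δ f → (∀ x → g (f x) ≡ x) → IsCellularMorphism 𝔖 γ δ (f , _* 𝔖 g)
  cellular-with-retraction γ δ f g f-pre gf≡id = f-pre , λ c x → cong c (gf≡id x)

  ∘C-inverse : (f : X → Y) (g : Y → X) →
    (∀ x → g (f x) ≡ x) → _≈M_ 𝔖 (_∘C_ 𝔖 (g , _* 𝔖 f) (f , _* 𝔖 g)) (idC 𝔖)
  ∘C-inverse f g gf≡id = gf≡id , λ c x → cong c (gf≡id x)

proposition1 : (𝔖 : Setting) {X Y : Set}
    (γ : X → C 𝔖 X) (δ : Y → C 𝔖 Y)
    → IsCellularAutomaton 𝔖 γ → IsCellularAutomaton 𝔖 δ
    → (x₀ : X) (y₀ : Y)
    → Reachable 𝔖 γ x₀ → Reachable 𝔖 δ y₀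
    → (f : X → Y) → IsPreCellular 𝔖 γ δ f → f x₀ ≡ y₀
    → (g : Y → X) → IsPreCellular 𝔖 δ γ g → g y₀ ≡ x₀
    → (∀ x → g (f x) ≡ x) × (∀ y → f (g y) ≡ y)
    × IsCellularMorphism 𝔖 γ δ (f , _* 𝔖 g)
    × IsCellularMorphism 𝔖 δ γ (g , _* 𝔖 f)
    × _≈M_ 𝔖 (_∘C_ 𝔖 (g , _* 𝔖 f) (f , _* 𝔖 g)) (idC 𝔖)
    × _≈M_ 𝔖 (_∘C_ 𝔖 (f , _* 𝔖 g) (g , _* 𝔖 f)) (idC 𝔖)
proposition1 𝔖 γ δ _ _ x₀ y₀ γ-reach δ-reach f f-pre fx₀≡y₀ g g-pre gy₀≡x₀ =
  gf≡id , fg≡id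
  , cellular-with-retraction 𝔖 γ δ f g f-pre gf≡id
  , cellular-with-retraction 𝔖 δ γ g f g-pre fg≡id
  , ∘C-inverse 𝔖 f g gf≡id , ∘C-inverse 𝔖 g f fg≡id
  where
  gf≡id : ∀ x → g (f x) ≡ x
  gf≡id = preCellular-retraction 𝔖 γ δ f g γ-reach f-pre fx₀≡y₀ g-pre gy₀≡x₀
  fg≡id : ∀ y → f (g y) ≡ y
  fg≡id = preCellular-retraction 𝔖 δ γ g f δ-reach g-pre gy₀≡x₀ f-pre fx₀≡y₀
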